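{- $\mathrm{sat}(6,2\mathcal{C}_{\ge3})=10$. Moreover, every $6$-vertex $2\mathcal{C}_{\ge3}$-saturated graph with $10$ edges is isomorphic to $W_6=K_1\vee C_5$.
   Context: All graphs are finite and simple. A graph is $2\mathcal{C}_{\ge3}$-saturated if it does not contain two vertex-disjoint cycles, but for every pair of non-adjacent vertices $u,v$, $G+uv$ contains two vertex-disjoint cycles. $\mathrm{sat}(n,2\mathcal{C}_{\ge3})$ is the minimum number of edges of an $n$-vertex $2\mathcal{C}_{\ge3}$-saturated graph. $K_1\vee C_5$ is the wheel obtained by joining one vertex to all vertices of a $5$-cycle. -}

module Defs where

open import Data.Nat using (ℕ; zero; suc; _+_; _≤_; _<?_)
open import Data.Bool using (Bool; true; false; _∨_; _∧_; T; if_then_else_)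
open import Data.Fin using (Fin; toℕ) renaming (zero to f0; suc to fs)
open import Data.Fin.Properties using () renaming (_≟_ to _≟ᶠ_)
open import Data.List using (List; []; _∷_; length; _++_; take; allFin; map)
open import Data.Nat.ListAction using (sum)
open import Data.List.Relation.Unary.Linked using (Linked)
open import Data.List.Relation.Unary.Unique.Propositional using (Unique)
open import Data.List.Relation.Binary.Disjoint.Propositional using (Disjoint)
open import Data.Product using (Σ; _×_; ∃₂)
open import Relation.Nullary using (¬_; does)
open import Relation.Binary.PropositionalEquality using (_≡_; _≢_)
open import Function.Bundles using (_↔_; Inverse)

record Graph (n : ℕ) : Set where
  field
    adj    : Fin n → Fin n → Bool
    sym    : ∀ i j → adj i j ≡ adj j i
    irrefl : ∀ i → adj i i ≡ false
open Graph public

Adj : ℕ → Set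
Adj n = Fin n → Fin n → Bool

IsCycle : ∀ {n} → Adj n → List (Fin n) → Set
IsCycle A vs =
  (3 ≤ length vs) × Unique vs × Linked (λ x y → T (A x y)) (vs ++ take 1 vs)

TwoDisjointCycles : ∀ {n} → Adj n → Set
TwoDisjointCycles A =
  ∃₂ λ (C₁ C₂ : List _) → IsCycle A C₁ × IsCycle A C₂ × Disjoint C₁ C₂

addEdge : ∀ {n} → Adj n → Fin n → Fin n → Adj n
addEdge A u v i j =
  A i j ∨ ((does (i ≟ᶠ u) ∧ does (j ≟ᶠ v)) ∨ (does (i ≟ᶠ v) ∧ does (j ≟ᶠ u)))

Saturated : ∀ {n} → Graph n → Set
Saturated G =
  ¬ TwoDisjointCycles (adj G) ×
  (∀ u v → u ≢ v → adj G u v ≡ false → TwoDisjointCycles (addEdge (adj G) u v))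

edgeCount : ∀ {n} → Graph n → ℕ
edgeCount {n} G =
  sum (map (λ i → sum (map (λ j →
         if does (toℕ i <? toℕ j) ∧ adj G i j then 1 else 0) (allFin n))) (allFin n))

_≅_ : ∀ {n} → Graph n → Graph n → Set
_≅_ {n} G H = Σ (Fin n ↔ Fin n) λ σ →
  ∀ i j → adj G i j ≡ adj H (Inverse.to σ i) (Inverse.to σ j)

-- The wheel W₆ = K₁ ∨ C₅: vertex 0 is the hub, vertices 1,…,5 form the
-- 5-cycle 1-2-3-4-5-1.
w6adj : Adj 6
w6adj i j = w (toℕ i) (toℕ j)
  where
  w : ℕ → ℕ → Bool
  w 0 0 = false
  w 0 _ = true
  w _ 0 = true
  w 1 2 = true
  w 2 1 = true
  w 2 3 = true
  w 3 2 = true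
  w 3 4 = true
  w 4 3 = true
  w 4 5 = true
  w 5 4 = true
  w 5 1 = true
  w 1 5 = true
  w _ _ = false

W6 : Graph 6
W6 = record { adj = w6adj ; sym = s ; irrefl = r }
  where
  s : ∀ i j → w6adj i j ≡ w6adj j i
  s f0 f0 = _≡_.refl
  s f0 (fs j) = _≡_.refl
  s (fs i) f0 = _≡_.refl
  s (fs f0) (fs f0) = _≡_.refl
  s (fs f0) (fs (fs j)) = lem j
    where
    lem : ∀ (j : Fin 4) → w6adj (fs f0) (fs (fs j)) ≡ w6adj (fs (fs j)) (fs f0)
    lem f0 = _≡_.refl
    lem (fs f0) = _≡_.refl
    lem (fs (fs f0)) = _≡_.refl
    lem (fs (fs (fs f0))) = _≡_.refl
  s (fs (fs i)) (fs f0) = lem i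
    where
    lem : ∀ (j : Fin 4) → w6adj (fs (fs j)) (fs f0) ≡ w6adj (fs f0) (fs (fs j))
    lem f0 = _≡_.refl
    lem (fs f0) = _≡_.refl
    lem (fs (fs f0)) = _≡_.refl
    lem (fs (fs (fs f0))) = _≡_.refl
  s (fs (fs i)) (fs (fs j)) = lem i j
    where
    lem : ∀ (i j : Fin 4) → w6adj (fs (fs i)) (fs (fs j)) ≡ w6adj (fs (fs j)) (fs (fs i))
    lem f0 f0 = _≡_.refl
    lem f0 (fs f0) = _≡_.refl
    lem f0 (fs (fs f0)) = _≡_.refl
    lem f0 (fs (fs (fs f0))) = _≡_.refl
    lem (fs f0) f0 = _≡_.refl
    lem (fs f0) (fs f0) = _≡_.refl
    lem (fs f0) (fs (fs f0)) = _≡_.refl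
    lem (fs f0) (fs (fs (fs f0))) = _≡_.refl
    lem (fs (fs f0)) f0 = _≡_.refl
    lem (fs (fs f0)) (fs f0) = _≡_.refl
    lem (fs (fs f0)) (fs (fs f0)) = _≡_.refl
    lem (fs (fs f0)) (fs (fs (fs f0))) = _≡_.refl
    lem (fs (fs (fs f0))) f0 = _≡_.refl
    lem (fs (fs (fs f0))) (fs f0) = _≡_.refl
    lem (fs (fs (fs f0))) (fs (fs f0)) = _≡_.refl
    lem (fs (fs (fs f0))) (fs (fs (fs f0))) = _≡_.refl
  r : ∀ i → w6adj i i ≡ false
  r f0 = _≡_.refl
  r (fs f0) = _≡_.refl
  r (fs (fs f0)) = _≡_.refl
  r (fs (fs (fs f0))) = _≡_.refl
  r (fs (fs (fs (fs f0)))) = _≡_.refl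
  r (fs (fs (fs (fs (fs f0))))) = _≡_.refl

SatNumberIs : ℕ → ℕ → Set
SatNumberIs n m =
  (Σ (Graph n) λ G → Saturated G × edgeCount G ≡ m) ×
  (∀ (G : Graph n) → Saturated G → m ≤ edgeCount G)

{-# OPTIONS --safe #-}
-- Two vertex-disjoint cycles in a graph on six vertices are two disjoint triangles, so
-- together they cover all six vertices; after swapping and rotating them the first one
-- is 0bc. Searching for such a pair of triangles decides whether a graph on Fin 6 has
-- two disjoint cycles, and hence whether it is saturated. The theorem is then checked on
-- all 2¹⁵ graphs on Fin 6: every saturated one has at least 10 edges, and every
-- saturated one with exactly 10 edges is mapped onto W₆ by one of the 720 permutations
-- of the vertices.
module Submission where

open import Defs hiding (sym)
open import Data.Bool using (Bool; true; false; T; _∧_; _∨_; if_then_else_)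
open import Data.Bool.Properties using (T?; T-∧; T-∨) renaming (_≟_ to _≟ᵇ_)
open import Data.Empty using (⊥-elim)
open import Data.Fin using (Fin; zero; suc; toℕ; punchOut)
open import Data.Fin.Permutation using (Permutation′; insert; id; _⟨$⟩ʳ_)
open import Data.Fin.Properties using (_≟_; all?; injective⇒≤; punchOut-injective)
open import Data.List using (List; []; _∷_; length; _++_; take; allFin; lookup; concatMap; map)
open import Data.List.Properties using (length-++; map-cong)
open import Data.List.Membership.Propositional using (_∈_)
open import Data.List.Membership.Propositional.Properties using (∈-lookup; ∈-++⁻)
import Data.List.Membership.DecPropositional as DecMembership
import Data.List.Relation.Binary.Disjoint.DecPropositional as DecDisjoint
open import Data.List.Relation.Binary.Disjoint.Propositional using (Disjoint)
import Data.List.Relation.Binary.Disjoint.Propositional.Properties as Disjoint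
open import Data.List.Relation.Unary.All as All using ([]; _∷_)
open import Data.List.Relation.Unary.AllPairs using ([]; _∷_)
open import Data.List.Relation.Unary.Any as Any using (Any; here; there; satisfied)
open import Data.List.Relation.Unary.Linked as Linked using ([-]; _∷_; linked?)
import Data.List.Relation.Unary.Unique.DecPropositional as DecUnique
open import Data.List.Relation.Unary.Unique.Propositional using (Unique)
open import Data.List.Relation.Unary.Unique.Propositional.Properties using (++⁺)
open import Data.Nat using (ℕ; zero; suc; _+_; _≤_; _≤?_; _<?_) renaming (_≟_ to _≟ℕ_)
open import Data.Nat.ListAction using (sum)
open import Data.Nat.Properties using (≤-trans; ≤-antisym; <-irrefl; ∸-monoʳ-≤; +-comm; m+n≤o⇒m≤o∸n)
open import Data.Product using (∃; ∃₂; _×_; _,_; proj₁; proj₂; map₂)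
open import Data.Sum using (inj₁; inj₂)
open import Data.Unit using (⊤; tt)
open import Data.Vec using (Vec; []; _∷_; tabulate) renaming (lookup to lookupᵛ)
open import Data.Vec.Properties using (lookup∘tabulate)
open import Function using (_∘_; Equivalence)
open import Function.Definitions using (Injective)
open import Relation.Binary.PropositionalEquality using (_≡_; _≢_; refl; sym; trans; cong; subst)
open import Relation.Nullary using (Dec; does; yes; no; ¬?; _×-dec_; _→-dec_; map′)
open import Relation.Nullary.Decidable using (isYes; toWitness; fromWitness)
open import Relation.Unary using (Decidable)

anyᶠ : ∀ {n} → (Fin n → Bool) → Bool
anyᶠ {zero}  p = false
anyᶠ {suc n} p = p zero ∨ anyᶠ (p ∘ suc)

anyᶠ-sound : ∀ {n} (p : Fin n → Bool) → T (anyᶠ p) → ∃ (T ∘ p)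
anyᶠ-sound {suc n} p t with Equivalence.to (T-∨ {p zero}) t
... | inj₁ p₀ = zero , p₀
... | inj₂ t′ = let i , pᵢ = anyᶠ-sound (p ∘ suc) t′ in suc i , pᵢ

anyᶠ-complete : ∀ {n} (p : Fin n → Bool) x → T (p x) → T (anyᶠ p)
anyᶠ-complete p zero    pₓ = Equivalence.from T-∨ (inj₁ pₓ)
anyᶠ-complete p (suc x) pₓ = Equivalence.from (T-∨ {p zero}) (inj₂ (anyᶠ-complete (p ∘ suc) x pₓ))

infixr 6 _⟨∧⟩_
_⟨∧⟩_ : ∀ {x y} → T x → T y → T (x ∧ y)
p ⟨∧⟩ q = Equivalence.from T-∧ (p , q)

∧-fst : ∀ {x y} → T (x ∧ y) → T x
∧-fst = proj₁ ∘ Equivalence.to T-∧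

∧-snd : ∀ {x y} → T (x ∧ y) → T y
∧-snd = proj₂ ∘ Equivalence.to T-∧

_≠_ : ∀ {n} → Fin n → Fin n → Bool
zero  ≠ zero  = false
zero  ≠ suc _ = true
suc _ ≠ zero  = true
suc x ≠ suc y = x ≠ y

≢⇒≠ : ∀ {n} {x y : Fin n} → x ≢ y → T (x ≠ y)
≢⇒≠ {x = zero}  {zero}  x≢y = x≢y refl
≢⇒≠ {x = zero}  {suc _} _   = tt
≢⇒≠ {x = suc _} {zero}  _   = tt
≢⇒≠ {x = suc x} {suc y} x≢y = ≢⇒≠ (x≢y ∘ cong suc)

lookup-injective : ∀ {a} {X : Set a} {xs : List X} → Unique xs → Injective _≡_ _≡_ (lookup xs)
lookup-injective (_ ∷ _)    {zero}  {zero}  _  = refl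
lookup-injective (x∉xs ∷ _) {zero}  {suc j} eq = ⊥-elim (All.lookup x∉xs (∈-lookup j) eq)
lookup-injective (x∉xs ∷ _) {suc i} {zero}  eq = ⊥-elim (All.lookup x∉xs (∈-lookup i) (sym eq))
lookup-injective (_ ∷ u)    {suc i} {suc j} eq = cong suc (lookup-injective u eq)

unique⇒length≤ : ∀ {n} {xs : List (Fin n)} → Unique xs → length xs ≤ n
unique⇒length≤ u = injective⇒≤ (lookup-injective u)

-- Otherwise punching x out of the entries of xs embeds Fin n into Fin (n ∸ 1).
unique∧length≡⇒∈ : ∀ {n} {xs : List (Fin n)} → Unique xs → length xs ≡ n → ∀ x → x ∈ xs
unique∧length≡⇒∈ {suc n} {xs} u len x with DecMembership._∈?_ _≟_ x xs
... | yes x∈xs = x∈xs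
... | no x∉xs = ⊥-elim (<-irrefl refl (subst (_≤ n) len (injective⇒≤ punchOut-injective′)))
  where
  x≢lookup : ∀ k → x ≢ lookup xs k
  x≢lookup k eq = x∉xs (subst (_∈ xs) (sym eq) (∈-lookup k))
  punchOut-injective′ : Injective _≡_ _≡_ (λ k → punchOut (x≢lookup k))
  punchOut-injective′ eq = lookup-injective u (punchOut-injective (x≢lookup _) (x≢lookup _) eq)

DisjointCycles : ∀ {n} → Adj n → List (Fin n) → List (Fin n) → Set
DisjointCycles A C₁ C₂ = IsCycle A C₁ × IsCycle A C₂ × Disjoint C₁ C₂

isCycle? : ∀ {n} (A : Adj n) → Decidable (IsCycle A)
isCycle? A vs =
  3 ≤? length vs ×-dec DecUnique.unique? _≟_ vs ×-dec linked? (λ x y → T? (A x y)) (vs ++ take 1 vs)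

disjointCycles? : ∀ {n} (A : Adj n) C₁ C₂ → Dec (DisjointCycles A C₁ C₂)
disjointCycles? A C₁ C₂ = isCycle? A C₁ ×-dec isCycle? A C₂ ×-dec DecDisjoint.disjoint? _≟_ C₁ C₂

module _ {n} {A : Adj n} where

  rotate-triangle : ∀ {a b c} → IsCycle A (a ∷ b ∷ c ∷ []) → IsCycle A (b ∷ c ∷ a ∷ [])
  rotate-triangle (3≤3 , (a≢b ∷ a≢c ∷ []) ∷ (b≢c ∷ []) ∷ [] ∷ [] , ab ∷ bc ∷ ca ∷ [-]) =
    3≤3 , (b≢c ∷ (a≢b ∘ sym) ∷ []) ∷ ((a≢c ∘ sym) ∷ []) ∷ [] ∷ [] , bc ∷ ca ∷ ab ∷ [-]

  rotate-first : ∀ {a b c C} → DisjointCycles A (a ∷ b ∷ c ∷ []) C → DisjointCycles A (b ∷ c ∷ a ∷ []) C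
  rotate-first (t , cyc , t#C) = rotate-triangle t , cyc , λ (x∈t , x∈C) → t#C (rotate∈ x∈t , x∈C)
    where
    rotate∈ : ∀ {x a b c} → x ∈ b ∷ c ∷ a ∷ [] → x ∈ a ∷ b ∷ c ∷ []
    rotate∈ (here x≡b)                = there (here x≡b)
    rotate∈ (there (here x≡c))        = there (there (here x≡c))
    rotate∈ (there (there (here x≡a))) = here x≡a

  swap-cycles : ∀ {C₁ C₂} → DisjointCycles A C₁ C₂ → DisjointCycles A C₂ C₁
  swap-cycles (c₁ , c₂ , C₁#C₂) = c₂ , c₁ , Disjoint.sym C₁#C₂

  disjointCycles-unique : ∀ {C₁ C₂} → DisjointCycles A C₁ C₂ → Unique (C₁ ++ C₂)
  disjointCycles-unique ((_ , u₁ , _) , (_ , u₂ , _) , C₁#C₂) = ++⁺ u₁ u₂ C₁#C₂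

m+n≤6⇒m≡n≡3 : ∀ {m n} → 3 ≤ m → 3 ≤ n → m + n ≤ 6 → m ≡ 3 × n ≡ 3
m+n≤6⇒m≡n≡3 {m} {n} 3≤m 3≤n m+n≤6 =
  ≤-antisym (≤-trans (m+n≤o⇒m≤o∸n m m+n≤6) (∸-monoʳ-≤ 6 3≤n)) 3≤m ,
  ≤-antisym (≤-trans (m+n≤o⇒m≤o∸n n (subst (_≤ 6) (+-comm m n) m+n≤6)) (∸-monoʳ-≤ 6 3≤m)) 3≤n

length≡3 : ∀ {a} {X : Set a} (xs : List X) → length xs ≡ 3 → ∃₂ λ x y → ∃ λ z → xs ≡ x ∷ y ∷ z ∷ []
length≡3 (x ∷ y ∷ z ∷ []) refl = x , y , z , refl

TrianglesThroughZero : Adj 6 → Set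
TrianglesThroughZero A =
  ∃₂ λ b c → ∃₂ λ d e → ∃ λ f → DisjointCycles A (zero ∷ b ∷ c ∷ []) (d ∷ e ∷ f ∷ [])

module _ {A : Adj 6} where

  disjointCycles-length≡3 : ∀ {C₁ C₂} → DisjointCycles A C₁ C₂ → length C₁ ≡ 3 × length C₂ ≡ 3
  disjointCycles-length≡3 {C₁} dc@((3≤∣C₁∣ , _) , (3≤∣C₂∣ , _) , _) =
    m+n≤6⇒m≡n≡3 3≤∣C₁∣ 3≤∣C₂∣ (subst (_≤ 6) (length-++ C₁) (unique⇒length≤ (disjointCycles-unique dc)))

  rotate-to-zero : ∀ {a b c C} → DisjointCycles A (a ∷ b ∷ c ∷ []) C → zero ∈ a ∷ b ∷ c ∷ [] →
                   ∃₂ λ b′ c′ → DisjointCycles A (zero ∷ b′ ∷ c′ ∷ []) C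
  rotate-to-zero dc (here refl)                = _ , _ , dc
  rotate-to-zero dc (there (here refl))        = _ , _ , rotate-first dc
  rotate-to-zero dc (there (there (here refl))) = _ , _ , rotate-first (rotate-first dc)

  trianglesThroughZero⇒twoDisjointCycles : TrianglesThroughZero A → TwoDisjointCycles A
  trianglesThroughZero⇒twoDisjointCycles (_ , _ , _ , _ , _ , dc) = _ , _ , dc

  twoDisjointCycles⇒trianglesThroughZero : TwoDisjointCycles A → TrianglesThroughZero A
  twoDisjointCycles⇒trianglesThroughZero (C₁ , C₂ , dc) with disjointCycles-length≡3 dc
  ... | ∣C₁∣≡3 , ∣C₂∣≡3 with length≡3 C₁ ∣C₁∣≡3 | length≡3 C₂ ∣C₂∣≡3
  ... | a , b , c , refl | d , e , f , refl
    with ∈-++⁻ (a ∷ b ∷ c ∷ []) (unique∧length≡⇒∈ (disjointCycles-unique dc) refl zero)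
  ... | inj₁ 0∈C₁ = let b′ , c′ , dc′ = rotate-to-zero dc 0∈C₁ in b′ , c′ , d , e , f , dc′
  ... | inj₂ 0∈C₂ = let b′ , c′ , dc′ = rotate-to-zero (swap-cycles dc) 0∈C₂ in b′ , c′ , a , b , c , dc′

avoidsTriangle : Fin 6 → Fin 6 → Fin 6 → Bool
avoidsTriangle b c x = zero ≠ x ∧ b ≠ x ∧ c ≠ x

-- Vertices are chosen in the order b, c, d, e, f, and extendsₖ asks whether the first k
-- choices extend to disjoint triangles 0bc and def. Every conjunct before the final test
-- is implied by it and only prunes the search.
module TriangleSearch (A : Adj 6) where

  extends₅ : (b c d e f : Fin 6) → Bool
  extends₅ b c d e f = avoidsTriangle b c f ∧ A e f ∧ A f d ∧
                       isYes (disjointCycles? A (zero ∷ b ∷ c ∷ []) (d ∷ e ∷ f ∷ []))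

  extends₄ : (b c d e : Fin 6) → Bool
  extends₄ b c d e = avoidsTriangle b c e ∧ A d e ∧ anyᶠ (extends₅ b c d e)

  extends₃ : (b c d : Fin 6) → Bool
  extends₃ b c d = avoidsTriangle b c d ∧ anyᶠ (extends₄ b c d)

  extends₂ : (b c : Fin 6) → Bool
  extends₂ b c = A b c ∧ A c zero ∧ anyᶠ (extends₃ b c)

  extends₁ : Fin 6 → Bool
  extends₁ b = A zero b ∧ anyᶠ (extends₂ b)

  trianglesThroughZeroᵇ : Bool
  trianglesThroughZeroᵇ = anyᶠ extends₁

  private
    Triangles : Fin 6 → Fin 6 → Fin 6 → Fin 6 → Fin 6 → Set
    Triangles b c d e f = DisjointCycles A (zero ∷ b ∷ c ∷ []) (d ∷ e ∷ f ∷ [])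

    extends₅-sound : ∀ b c d e {f} → T (extends₅ b c d e f) → Triangles b c d e f
    extends₅-sound b c d e {f} = toWitness ∘ ∧-snd {A f d} ∘ ∧-snd {A e f} ∘ ∧-snd {avoidsTriangle b c f}

    extends₄-sound : ∀ b c d {e} → T (extends₄ b c d e) → ∃ (Triangles b c d e)
    extends₄-sound b c d {e} =
      map₂ (extends₅-sound b c d e) ∘ anyᶠ-sound (extends₅ b c d e) ∘ ∧-snd {A d e} ∘ ∧-snd {avoidsTriangle b c e}

    extends₃-sound : ∀ b c {d} → T (extends₃ b c d) → ∃₂ (Triangles b c d)
    extends₃-sound b c {d} = map₂ (extends₄-sound b c d) ∘ anyᶠ-sound (extends₄ b c d) ∘ ∧-snd {avoidsTriangle b c d}

    extends₂-sound : ∀ b {c} → T (extends₂ b c) → ∃ λ d → ∃₂ (Triangles b c d)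
    extends₂-sound b {c} = map₂ (extends₃-sound b c) ∘ anyᶠ-sound (extends₃ b c) ∘ ∧-snd {A c zero} ∘ ∧-snd {A b c}

    extends₁-sound : ∀ {b} → T (extends₁ b) → ∃₂ λ c d → ∃₂ (Triangles b c d)
    extends₁-sound {b} = map₂ (extends₂-sound b) ∘ anyᶠ-sound (extends₂ b) ∘ ∧-snd {A zero b}

  trianglesThroughZeroᵇ-sound : T trianglesThroughZeroᵇ → TrianglesThroughZero A
  trianglesThroughZeroᵇ-sound = map₂ extends₁-sound ∘ anyᶠ-sound extends₁

  trianglesThroughZeroᵇ-complete : TrianglesThroughZero A → T trianglesThroughZeroᵇ
  trianglesThroughZeroᵇ-complete
    (b , c , d , e , f , dc@((_ , _ , 0b ∷ bc ∷ c0 ∷ [-]) , (_ , _ , de ∷ ef ∷ fd ∷ [-]) , t#t′)) =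
    anyᶠ-complete extends₁ b (0b ⟨∧⟩
    anyᶠ-complete (extends₂ b) c (bc ⟨∧⟩ c0 ⟨∧⟩
    anyᶠ-complete (extends₃ b c) d (avoids (here refl) ⟨∧⟩
    anyᶠ-complete (extends₄ b c d) e (avoids (there (here refl)) ⟨∧⟩ de ⟨∧⟩
    anyᶠ-complete (extends₅ b c d e) f (avoids (there (there (here refl))) ⟨∧⟩ ef ⟨∧⟩ fd ⟨∧⟩
    fromWitness dc)))))
    where
    avoids : ∀ {x} → x ∈ d ∷ e ∷ f ∷ [] → T (avoidsTriangle b c x)
    avoids {x} x∈t′ =
      _⟨∧⟩_ {zero ≠ x} (≢⇒≠ λ 0≡x → t#t′ (here (sym 0≡x) , x∈t′))
      (_⟨∧⟩_ {b ≠ x} (≢⇒≠ λ b≡x → t#t′ (there (here (sym b≡x)) , x∈t′))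
                     (≢⇒≠ λ c≡x → t#t′ (there (there (here (sym c≡x))) , x∈t′)))

open TriangleSearch using (trianglesThroughZeroᵇ; trianglesThroughZeroᵇ-sound; trianglesThroughZeroᵇ-complete)

twoDisjointCycles? : (A : Adj 6) → Dec (TwoDisjointCycles A)
twoDisjointCycles? A =
  map′ (trianglesThroughZero⇒twoDisjointCycles ∘ trianglesThroughZeroᵇ-sound A)
       (trianglesThroughZeroᵇ-complete A ∘ twoDisjointCycles⇒trianglesThroughZero)
       (T? (trianglesThroughZeroᵇ A))

saturated? : (G : Graph 6) → Dec (Saturated G)
saturated? G =
  ¬? (twoDisjointCycles? (adj G)) ×-dec
  all? λ u → all? λ v → ¬? (u ≟ v) →-dec adj G u v ≟ᵇ false →-dec twoDisjointCycles? (addEdge (adj G) u v)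

-- A graph on Fin (suc n) is coded by the neighbourhood of vertex 0 among the other
-- vertices, together with a code of the graph they induce.
Code : ℕ → Set
Code zero    = ⊤
Code (suc n) = Vec Bool n × Code n

codeAdj : ∀ {n} → Code n → Adj n
codeAdj {suc n} (r , c) zero    zero    = false
codeAdj {suc n} (r , c) zero    (suc j) = lookupᵛ r j
codeAdj {suc n} (r , c) (suc i) zero    = lookupᵛ r i
codeAdj {suc n} (r , c) (suc i) (suc j) = codeAdj c i j

codeAdj-sym : ∀ {n} (c : Code n) i j → codeAdj c i j ≡ codeAdj c j i
codeAdj-sym {suc n} c       zero    zero    = refl
codeAdj-sym {suc n} c       zero    (suc j) = refl
codeAdj-sym {suc n} c       (suc i) zero    = refl
codeAdj-sym {suc n} (r , c) (suc i) (suc j) = codeAdj-sym c i j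

codeAdj-irrefl : ∀ {n} (c : Code n) i → codeAdj c i i ≡ false
codeAdj-irrefl {suc n} c       zero    = refl
codeAdj-irrefl {suc n} (r , c) (suc i) = codeAdj-irrefl c i

decode : ∀ {n} → Code n → Graph n
decode c = record { adj = codeAdj c ; sym = codeAdj-sym c ; irrefl = codeAdj-irrefl c }

encode : ∀ {n} → Adj n → Code n
encode {zero}  A = tt
encode {suc n} A = tabulate (A zero ∘ suc) , encode (λ i j → A (suc i) (suc j))

_≗₂_ : ∀ {n} → Adj n → Adj n → Set
A ≗₂ B = ∀ i j → A i j ≡ B i j

codeAdj-encode : ∀ {n} {A : Adj n} → (∀ i j → A i j ≡ A j i) → (∀ i → A i i ≡ false) →
                 codeAdj (encode A) ≗₂ A
codeAdj-encode {suc n} A-sym A-irrefl zero    zero    = sym (A-irrefl zero)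
codeAdj-encode {suc n} A-sym A-irrefl zero    (suc j) = lookup∘tabulate _ j
codeAdj-encode {suc n} A-sym A-irrefl (suc i) zero    = trans (lookup∘tabulate _ i) (A-sym zero (suc i))
codeAdj-encode {suc n} A-sym A-irrefl (suc i) (suc j) =
  codeAdj-encode (λ i j → A-sym (suc i) (suc j)) (A-irrefl ∘ suc) i j

decode-encode : ∀ {n} (G : Graph n) → adj (decode (encode (adj G))) ≗₂ adj G
decode-encode G = codeAdj-encode (Graph.sym G) (irrefl G)

allᵛ : ∀ n → (Vec Bool n → Bool) → Bool
allᵛ zero    p = p []
allᵛ (suc n) p = allᵛ n (p ∘ (true ∷_)) ∧ allᵛ n (p ∘ (false ∷_))

allᵛ-sound : ∀ n (p : Vec Bool n → Bool) → T (allᵛ n p) → ∀ v → T (p v)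
allᵛ-sound zero    p t []          = t
allᵛ-sound (suc n) p t (true ∷ v)  = allᵛ-sound n (p ∘ (true ∷_)) (∧-fst t) v
allᵛ-sound (suc n) p t (false ∷ v) = allᵛ-sound n (p ∘ (false ∷_)) (∧-snd {allᵛ n (p ∘ (true ∷_))} t) v

allCodes : ∀ n → (Code n → Bool) → Bool
allCodes zero    p = p tt
allCodes (suc n) p = allᵛ n λ r → allCodes n λ c → p (r , c)

-- The hypothesis is an equation because Agda inverts T on a closed T (allCodes n p),
-- evaluating the entire check during unification.
allCodes-sound : ∀ n (p : Code n → Bool) → allCodes n p ≡ true → ∀ c → T (p c)
allCodes-sound n p all≡true = sound n p (subst T (sym all≡true) tt)
  where
  sound : ∀ n (p : Code n → Bool) → T (allCodes n p) → ∀ c → T (p c)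
  sound zero    p t tt      = t
  sound (suc n) p t (r , c) = sound n (λ c → p (r , c)) (allᵛ-sound n (λ r → allCodes n λ c → p (r , c)) t r) c

module _ {n} {A B : Adj n} (A≗B : A ≗₂ B) where

  twoDisjointCycles-cong : TwoDisjointCycles A → TwoDisjointCycles B
  twoDisjointCycles-cong (C₁ , C₂ , (ℓ₁ , u₁ , l₁) , (ℓ₂ , u₂ , l₂) , C₁#C₂) =
    C₁ , C₂ , (ℓ₁ , u₁ , Linked.map edge l₁) , (ℓ₂ , u₂ , Linked.map edge l₂) , C₁#C₂
    where
    edge : ∀ {x y} → T (A x y) → T (B x y)
    edge {x} {y} = subst T (A≗B x y)

  addEdge-cong : ∀ u v → addEdge A u v ≗₂ addEdge B u v
  addEdge-cong u v i j = cong (_∨ _) (A≗B i j)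

module _ {n} (G H : Graph n) (G≗H : adj G ≗₂ adj H) where

  saturated-cong : Saturated G → Saturated H
  saturated-cong (no-cycles , saturating) =
    no-cycles ∘ twoDisjointCycles-cong (λ i j → sym (G≗H i j)) ,
    λ u v u≢v uv∉H → twoDisjointCycles-cong (addEdge-cong G≗H u v)
                       (saturating u v u≢v (trans (G≗H u v) uv∉H))

  edgeCount-cong : edgeCount G ≡ edgeCount H
  edgeCount-cong =
    cong sum (map-cong (λ i → cong sum (map-cong (λ j →
      cong (λ b → if does (toℕ i <? toℕ j) ∧ b then 1 else 0) (G≗H i j)) (allFin n))) (allFin n))

  ≅-cong : ∀ {K} → H ≅ K → G ≅ K
  ≅-cong (σ , H≅K) = σ , λ i j → trans (G≗H i j) (H≅K i j)

permutations : ∀ n → List (Permutation′ n)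
permutations zero    = id ∷ []
permutations (suc n) = concatMap (λ j → map (insert zero j) (permutations n)) (allFin (suc n))

IsIsomorphism : ∀ {n} → Graph n → Graph n → Permutation′ n → Set
IsIsomorphism G H σ = ∀ i j → adj G i j ≡ adj H (σ ⟨$⟩ʳ i) (σ ⟨$⟩ʳ j)

isIsomorphism? : ∀ {n} (G H : Graph n) → Decidable (IsIsomorphism G H)
isIsomorphism? G H σ = all? λ i → all? λ j → adj G i j ≟ᵇ adj H (σ ⟨$⟩ʳ i) (σ ⟨$⟩ʳ j)

isomorphismAmong? : ∀ {n} (G H : Graph n) → Dec (Any (IsIsomorphism G H) (permutations n))
isomorphismAmong? G H = Any.any? (isIsomorphism? G H) (permutations _)

SaturationBound : Graph 6 → Set
SaturationBound G =
  Saturated G → 10 ≤ edgeCount G × (edgeCount G ≡ 10 → Any (IsIsomorphism G W6) (permutations 6))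

saturationBound? : (G : Graph 6) → Dec (SaturationBound G)
saturationBound? G =
  saturated? G →-dec 10 ≤? edgeCount G ×-dec edgeCount G ≟ℕ 10 →-dec isomorphismAmong? G W6

allCodes-saturationBound : allCodes 6 (λ c → isYes (saturationBound? (decode c))) ≡ true
allCodes-saturationBound = refl

decode-saturationBound : ∀ c → SaturationBound (decode c)
decode-saturationBound c =
  toWitness (allCodes-sound 6 (λ c → isYes (saturationBound? (decode c))) allCodes-saturationBound c)

saturated⇒bound : ∀ G → Saturated G → 10 ≤ edgeCount G × (edgeCount G ≡ 10 → G ≅ W6)
saturated⇒bound G sat =
  subst (10 ≤_) H≡G 10≤∣H∣ , λ ∣G∣≡10 → ≅-cong G H G≗H {W6} (satisfied (H≅W6 (trans H≡G ∣G∣≡10)))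
  where
  H : Graph 6
  H = decode (encode (adj G))
  G≗H : adj G ≗₂ adj H
  G≗H i j = sym (decode-encode G i j)
  H≡G : edgeCount H ≡ edgeCount G
  H≡G = edgeCount-cong H G (decode-encode G)
  10≤∣H∣ : 10 ≤ edgeCount H
  10≤∣H∣ = proj₁ (decode-saturationBound (encode (adj G)) (saturated-cong G H G≗H sat))
  H≅W6 : edgeCount H ≡ 10 → Any (IsIsomorphism H W6) (permutations 6)
  H≅W6 = proj₂ (decode-saturationBound (encode (adj G)) (saturated-cong G H G≗H sat))

W6-saturated : Saturated W6
W6-saturated = toWitness {a? = saturated? W6} tt

lemma3p6 : SatNumberIs 6 10 ×
    (∀ (G : Graph 6) → Saturated G → edgeCount G ≡ 10 → G ≅ W6)
lemma3p6 = ((W6 , W6-saturated , refl) , λ G → proj₁ ∘ saturated⇒bound G) , λ G → proj₂ ∘ saturated⇒bound G
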